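{- Let $B_2=\{312,321,1342\}$. A nonempty permutation belongs to $\operatorname{Av}(B_2)$ if and only if it is of the form $(\pi\ominus 1)\oplus\sigma$, where $\pi$ is an increasing permutation (possibly empty) and $\sigma$ is a Fibonacci permutation (possibly empty).
   Context: For a set $S$ of permutations, $\operatorname{Av}(S)$ is the set of all permutations avoiding every pattern in $S$ (classical pattern avoidance). A Fibonacci permutation is a permutation in $\operatorname{Av}(231,312,321)$. For permutations $\pi$ of length $n$ and $\sigma$ of length $k$, $\pi\oplus\sigma$ is $\pi$ followed by $\sigma$ with every entry of $\sigma$ increased by $n$; $\pi\ominus\sigma$ is $\pi$ followed by $\sigma$ with every entry of $\pi$ increased by $k$. Here $1$ denotes the permutation of length one. -}

module Defs where

open import Data.Nat using (ℕ; suc; _+_; _<_)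
open import Data.List using (List; []; _∷_; _++_; map; length; upTo; lookup)
open import Data.List.Relation.Binary.Permutation.Propositional using (_↭_)
open import Data.Fin using (Fin) renaming (_<_ to _<ᶠ_)
open import Data.Product using (Σ; _×_)
open import Relation.Nullary using (¬_)

IsPerm : List ℕ → Set
IsPerm w = w ↭ map suc (upTo (length w))

inc : ℕ → List ℕ
inc n = map suc (upTo n)

_⊕_ : List ℕ → List ℕ → List ℕ
π ⊕ σ = π ++ map (_+ length π) σ

_⊖_ : List ℕ → List ℕ → List ℕ
π ⊖ σ = map (_+ length σ) π ++ σ

infixl 6 _⊕_ _⊖_

Contains : List ℕ → List ℕ → Set
Contains w p =
  Σ (Fin (length p) → Fin (length w)) λ f →
    (∀ i j → i <ᶠ j → f i <ᶠ f j) ×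
    (∀ i j → (lookup p i < lookup p j → lookup w (f i) < lookup w (f j))
           × (lookup w (f i) < lookup w (f j) → lookup p i < lookup p j))

Avoids : List ℕ → List ℕ → Set
Avoids w p = ¬ Contains w p

IsFibonacci : List ℕ → Set
IsFibonacci w = IsPerm w × Avoids w (2 ∷ 3 ∷ 1 ∷ []) × Avoids w (3 ∷ 1 ∷ 2 ∷ [])
                × Avoids w (3 ∷ 2 ∷ 1 ∷ [])

InAvB2 : List ℕ → Set
InAvB2 w = IsPerm w × Avoids w (3 ∷ 1 ∷ 2 ∷ []) × Avoids w (3 ∷ 2 ∷ 1 ∷ [])
           × Avoids w (1 ∷ 3 ∷ 4 ∷ 2 ∷ [])

-- Let 1 sit at position m of w ∈ Av(312, 321, 1342). The entries before it
-- increase (a descent there would form a 321 with the 1) and lie below all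
-- entries after it (otherwise a 312 with the 1 in the middle), hence they are
-- 2, 3, …, m + 1 and w = (12⋯m ⊖ 1) ⊕ σ. The summand σ avoids 312 and 321
-- because w does, and 231 because the 1 followed by a 231 of σ is a 1342.
-- Conversely, in π ⊕ σ every entry of π lies below every entry of σ, so an
-- occurrence cannot have the two ends of an inversion in different summands.
-- Hence an occurrence of 312 or 321 lies in one summand, and so does the 342
-- of a 1342 or else the whole 1342; but 12⋯m ⊖ 1 = 23⋯(m+1)1 contains none of
-- them, as each of its inversions ends at its minimum 1.
module Submission where

open import Defs
open import Data.Nat using (ℕ; zero; suc; _+_; _∸_; _<_; _≤_; z≤n; s≤s; z<s; s<s; _<?_)
open import Data.Nat.Properties
open import Data.Nat.Induction using (<-rec)
open import Data.List using (List; []; _∷_; _++_; map; length; upTo; applyUpTo; lookup; take; drop)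
open import Data.List.Properties
  using ( length-map; length-++; length-upTo; length-take; length-drop
        ; map-upTo; map-cong; map-∘; map-id; map-id-local; take++drop≡id )
open import Data.List.Membership.Propositional.Properties
  using (∈-map⁺; ∈-map⁻; ∈-upTo⁺; ∈-upTo⁻)
open import Data.List.Relation.Binary.Permutation.Propositional
  using (_↭_; ↭-sym; ↭-trans; ↭-reflexive; ↭⇒↭ₛ)
open import Data.List.Relation.Binary.Permutation.Propositional.Properties
  using (∈-resp-↭; ↭-length; ++⁺; ++⁺ʳ; ++-comm; map⁺; drop-∷)
import Data.List.Relation.Binary.Permutation.Setoid.Properties as PermutationProperties
import Data.List.Relation.Unary.Unique.Propositional.Properties as Unique
open import Data.List.Membership.Propositional using (_∈_)
open import Data.List.Relation.Unary.Any using (here; there)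
open import Data.List.Relation.Unary.All as All using ()
open import Data.List.Relation.Unary.AllPairs using (_∷_)
open import Data.List.Relation.Unary.Unique.Propositional using (Unique)
open import Data.Fin as Fin using (Fin; toℕ; fromℕ<)
open import Data.Fin.Properties using (toℕ<n; toℕ-fromℕ<)
open import Data.Product using (Σ; ∃; _×_; _,_; proj₁; proj₂)
open import Data.Sum using (_⊎_; inj₁; inj₂)
open import Data.Empty using (⊥-elim)
open import Function using (_∘_)
open import Function.Bundles using (_⇔_; mk⇔)
open import Relation.Binary.PropositionalEquality
open import Relation.Binary.Definitions using (tri<; tri≈; tri>)
open import Relation.Nullary using (¬_; yes; no)

-- Positions in lists

-- Total indexing: past the end the junk value 0 is returned.
nth : List ℕ → ℕ → ℕ
nth []       _       = 0
nth (x ∷ _)  zero    = x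
nth (_ ∷ xs) (suc k) = nth xs k

lookup≡nth : ∀ xs (i : Fin (length xs)) → lookup xs i ≡ nth xs (toℕ i)
lookup≡nth (x ∷ xs) Fin.zero    = refl
lookup≡nth (x ∷ xs) (Fin.suc i) = lookup≡nth xs i

nth-map : ∀ f xs {k} → k < length xs → nth (map f xs) k ≡ f (nth xs k)
nth-map f (x ∷ xs) {zero}  _          = refl
nth-map f (x ∷ xs) {suc k} (s≤s k<n) = nth-map f xs k<n

nth-++ˡ : ∀ xs ys {k} → k < length xs → nth (xs ++ ys) k ≡ nth xs k
nth-++ˡ (x ∷ xs) ys {zero}  _          = refl
nth-++ˡ (x ∷ xs) ys {suc k} (s≤s k<n) = nth-++ˡ xs ys k<n

nth-++ʳ : ∀ xs ys k → nth (xs ++ ys) (length xs + k) ≡ nth ys k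
nth-++ʳ []       ys k = refl
nth-++ʳ (x ∷ xs) ys k = nth-++ʳ xs ys k

nth-take : ∀ n xs {k} → k < n → nth (take n xs) k ≡ nth xs k
nth-take (suc n) []                 _          = refl
nth-take (suc n) (x ∷ xs) {zero}  _          = refl
nth-take (suc n) (x ∷ xs) {suc k} (s≤s k<n) = nth-take n xs k<n

nth-drop : ∀ n xs k → nth (drop n xs) k ≡ nth xs (n + k)
nth-drop zero    xs       k = refl
nth-drop (suc n) []       k = refl
nth-drop (suc n) (x ∷ xs) k = nth-drop n xs k

nth-applyUpTo : ∀ f n {k} → k < n → nth (applyUpTo f n) k ≡ f k
nth-applyUpTo f (suc n) {zero}  _          = refl
nth-applyUpTo f (suc n) {suc k} (s≤s k<n) = nth-applyUpTo (f ∘ suc) n k<n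

nth-ext : ∀ {xs ys} → length xs ≡ length ys →
          (∀ {k} → k < length xs → nth xs k ≡ nth ys k) → xs ≡ ys
nth-ext {[]}     {[]}     _  _  = refl
nth-ext {x ∷ xs} {y ∷ ys} eq pt =
  cong₂ _∷_ (pt (s≤s z≤n)) (nth-ext (suc-injective eq) (pt ∘ s≤s))

nth-∈ : ∀ xs {k} → k < length xs → nth xs k ∈ xs
nth-∈ (x ∷ xs) {zero}  _          = here refl
nth-∈ (x ∷ xs) {suc k} (s≤s k<n) = there (nth-∈ xs k<n)

∈⇒nth : ∀ {x} xs → x ∈ xs → ∃ λ k → k < length xs × nth xs k ≡ x
∈⇒nth (_ ∷ xs) (here refl) = 0 , s≤s z≤n , refl
∈⇒nth (_ ∷ xs) (there x∈)  with k , k<n , eq ← ∈⇒nth xs x∈ = suc k , s≤s k<n , eq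

nth-distinct : ∀ {xs i j} → Unique xs → i < j → j < length xs → nth xs i ≢ nth xs j
nth-distinct {x ∷ xs} {zero}  {suc j} (x∉xs ∷ _)  _          (s≤s j<n) =
  All.lookup x∉xs (nth-∈ xs j<n)
nth-distinct {x ∷ xs} {suc i} {suc j} (_ ∷ uniq) (s≤s i<j) (s≤s j<n) = nth-distinct uniq i<j j<n

nth-injective : ∀ {xs i j} → Unique xs → i < length xs → j < length xs →
                nth xs i ≡ nth xs j → i ≡ j
nth-injective {i = i} {j} uniq i<n j<n eq with <-cmp i j
... | tri< i<j _ _ = ⊥-elim (nth-distinct uniq i<j j<n eq)
... | tri≈ _ i≡j _ = i≡j
... | tri> _ _ j<i = ⊥-elim (nth-distinct uniq j<i i<n (sym eq))

-- Pattern occurrences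

-- Contains with positions given as a function on ℕ; only pos i for
-- i < length p matters.
record Occurrence (w p : List ℕ) : Set where
  field
    pos       : ℕ → ℕ
    pos-bound : ∀ {i} → i < length p → pos i < length w
    pos-mono  : ∀ {i j} → i < j → j < length p → pos i < pos j
    preserves : ∀ {i j} → i < length p → j < length p →
                nth p i < nth p j → nth w (pos i) < nth w (pos j)
    reflects  : ∀ {i j} → i < length p → j < length p →
                nth w (pos i) < nth w (pos j) → nth p i < nth p j
open Occurrence

extend : ∀ {n} → (Fin n → ℕ) → ℕ → ℕ
extend {zero}  g _       = 0
extend {suc n} g zero    = g Fin.zero
extend {suc n} g (suc k) = extend (g ∘ Fin.suc) k

extend-toℕ : ∀ {n} (g : Fin n → ℕ) i → extend g (toℕ i) ≡ g i
extend-toℕ g Fin.zero    = refl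
extend-toℕ g (Fin.suc i) = extend-toℕ (g ∘ Fin.suc) i

extend-fromℕ< : ∀ {n} (g : Fin n → ℕ) {k} (k<n : k < n) → extend g k ≡ g (fromℕ< k<n)
extend-fromℕ< g k<n =
  trans (cong (extend g) (sym (toℕ-fromℕ< k<n))) (extend-toℕ g (fromℕ< k<n))

contains⇒occurrence : ∀ {w p} → Contains w p → Occurrence w p
contains⇒occurrence {w} {p} (f , f-mono , f-order) = record
  { pos       = pos′
  ; pos-bound = λ i<n → subst (_< length w) (sym (pos-at i<n)) (toℕ<n _)
  ; pos-mono  = λ i<j j<n → let i<n = <-trans i<j j<n in
      subst₂ _<_ (sym (pos-at i<n)) (sym (pos-at j<n))
        (f-mono _ _ (subst₂ _<_ (sym (toℕ-fromℕ< i<n)) (sym (toℕ-fromℕ< j<n)) i<j))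
  ; preserves = λ i<n j<n lt → subst₂ _<_ (text-at i<n) (text-at j<n)
      (proj₁ (f-order _ _) (subst₂ _<_ (pattern-at i<n) (pattern-at j<n) lt))
  ; reflects  = λ i<n j<n lt → subst₂ _<_ (sym (pattern-at i<n)) (sym (pattern-at j<n))
      (proj₂ (f-order _ _) (subst₂ _<_ (sym (text-at i<n)) (sym (text-at j<n)) lt))
  }
  where
  pos′ : ℕ → ℕ
  pos′ = extend (toℕ ∘ f)
  pos-at : ∀ {i} (i<n : i < length p) → pos′ i ≡ toℕ (f (fromℕ< i<n))
  pos-at = extend-fromℕ< (toℕ ∘ f)
  pattern-at : ∀ {i} (i<n : i < length p) → nth p i ≡ lookup p (fromℕ< i<n)
  pattern-at i<n = trans (cong (nth p) (sym (toℕ-fromℕ< i<n))) (sym (lookup≡nth p _))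
  text-at : ∀ {i} (i<n : i < length p) → lookup w (f (fromℕ< i<n)) ≡ nth w (pos′ i)
  text-at i<n = trans (lookup≡nth w _) (cong (nth w) (sym (pos-at i<n)))

occurrence⇒contains : ∀ {w p} → Occurrence w p → Contains w p
occurrence⇒contains {w} {p} o = f , f-mono , λ i j →
    (λ lt → subst₂ _<_ (sym (text-at i)) (sym (text-at j))
       (preserves o (toℕ<n i) (toℕ<n j) (subst₂ _<_ (lookup≡nth p i) (lookup≡nth p j) lt)))
  , (λ lt → subst₂ _<_ (sym (lookup≡nth p i)) (sym (lookup≡nth p j))
       (reflects o (toℕ<n i) (toℕ<n j) (subst₂ _<_ (text-at i) (text-at j) lt)))
  where
  f : Fin (length p) → Fin (length w)
  f i = fromℕ< (pos-bound o (toℕ<n i))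
  f-mono : ∀ i j → toℕ i < toℕ j → toℕ (f i) < toℕ (f j)
  f-mono i j i<j = subst₂ _<_ (sym (toℕ-fromℕ< _)) (sym (toℕ-fromℕ< _)) (pos-mono o i<j (toℕ<n j))
  text-at : ∀ i → lookup w (f i) ≡ nth w (pos o (toℕ i))
  text-at i = trans (lookup≡nth w (f i)) (cong (nth w) (toℕ-fromℕ< _))

¬occurrence : ∀ {w p} → Avoids w p → ¬ Occurrence w p
¬occurrence w-avoids = w-avoids ∘ occurrence⇒contains

avoids-along : ∀ {u w p q} → (Occurrence u p → Occurrence w q) → Avoids w q → Avoids u p
avoids-along transfer w-avoids = ¬occurrence w-avoids ∘ transfer ∘ contains⇒occurrence

occurrence-trans : ∀ {w u p} → Occurrence w u → Occurrence u p → Occurrence w p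
occurrence-trans o o′ = record
  { pos       = pos o ∘ pos o′
  ; pos-bound = pos-bound o ∘ pos-bound o′
  ; pos-mono  = λ i<j j<n → pos-mono o (pos-mono o′ i<j j<n) (pos-bound o′ j<n)
  ; preserves = λ i<n j<n → preserves o (pos-bound o′ i<n) (pos-bound o′ j<n) ∘ preserves o′ i<n j<n
  ; reflects  = λ i<n j<n → reflects o′ i<n j<n ∘ reflects o (pos-bound o′ i<n) (pos-bound o′ j<n)
  }

occurrence-[] : ∀ {w} → Occurrence w []
occurrence-[] = record
  { pos = λ i → i ; pos-bound = λ () ; pos-mono = λ _ () ; preserves = λ () ; reflects = λ () }

occurrence-∷ : ∀ {w q a x} (o : Occurrence w q) → a < length w →
  (∀ {j} → j < length q → a < pos o j) →
  (∀ {j} → j < length q → (x < nth q j × nth w a < nth w (pos o j))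
                        ⊎ (nth q j < x × nth w (pos o j) < nth w a)) →
  Occurrence w (x ∷ q)
occurrence-∷ {w} {q} {a} {x} o a<n a<pos compare = record
  { pos = pos′ ; pos-bound = bound ; pos-mono = mono ; preserves = pres ; reflects = refl′ }
  where
  pos′ : ℕ → ℕ
  pos′ zero    = a
  pos′ (suc i) = pos o i
  bound : ∀ {i} → i < suc (length q) → pos′ i < length w
  bound {zero}  _          = a<n
  bound {suc i} (s≤s i<n) = pos-bound o i<n
  mono : ∀ {i j} → i < j → j < suc (length q) → pos′ i < pos′ j
  mono {zero}  {suc j} _          (s≤s j<n) = a<pos j<n
  mono {suc i} {suc j} (s≤s i<j) (s≤s j<n) = pos-mono o i<j j<n
  pres : ∀ {i j} → i < suc (length q) → j < suc (length q) →
         nth (x ∷ q) i < nth (x ∷ q) j → nth w (pos′ i) < nth w (pos′ j)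
  pres {zero}  {zero}  _          _          lt = ⊥-elim (<-irrefl refl lt)
  pres {zero}  {suc j} _          (s≤s j<n) lt with compare j<n
  ... | inj₁ (_ , gt)  = gt
  ... | inj₂ (q<x , _) = ⊥-elim (<-asym lt q<x)
  pres {suc i} {zero}  (s≤s i<n) _          lt with compare i<n
  ... | inj₁ (x<q , _) = ⊥-elim (<-asym lt x<q)
  ... | inj₂ (_ , lt′) = lt′
  pres {suc i} {suc j} (s≤s i<n) (s≤s j<n) lt = preserves o i<n j<n lt
  refl′ : ∀ {i j} → i < suc (length q) → j < suc (length q) →
          nth w (pos′ i) < nth w (pos′ j) → nth (x ∷ q) i < nth (x ∷ q) j
  refl′ {zero}  {zero}  _          _          lt = ⊥-elim (<-irrefl refl lt)
  refl′ {zero}  {suc j} _          (s≤s j<n) lt with compare j<n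
  ... | inj₁ (x<q , _) = x<q
  ... | inj₂ (_ , lt′) = ⊥-elim (<-asym lt lt′)
  refl′ {suc i} {zero}  (s≤s i<n) _          lt with compare i<n
  ... | inj₁ (_ , gt)  = ⊥-elim (<-asym lt gt)
  ... | inj₂ (q<x , _) = q<x
  refl′ {suc i} {suc j} (s≤s i<n) (s≤s j<n) lt = reflects o i<n j<n lt

occurrence-map-+ : ∀ {w q} c → Occurrence w q → Occurrence w (map (_+ c) q)
occurrence-map-+ {w} {q} c o = record
  { pos       = pos o
  ; pos-bound = pos-bound o ∘ shrink
  ; pos-mono  = λ i<j j<n → pos-mono o i<j (shrink j<n)
  ; preserves = λ i<n j<n lt → preserves o (shrink i<n) (shrink j<n)
      (+-cancelʳ-< c _ _ (subst₂ _<_ (entry i<n) (entry j<n) lt))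
  ; reflects  = λ i<n j<n lt → subst₂ _<_ (sym (entry i<n)) (sym (entry j<n))
      (+-monoˡ-< c (reflects o (shrink i<n) (shrink j<n) lt))
  }
  where
  shrink : ∀ {i} → i < length (map (_+ c) q) → i < length q
  shrink = subst (_ <_) (length-map (_+ c) q)
  entry : ∀ {i} (i<n : i < length (map (_+ c) q)) → nth (map (_+ c) q) i ≡ nth q i + c
  entry i<n = nth-map (_+ c) q (shrink i<n)

record Factor (u w : List ℕ) : Set where
  field
    offset shift : ℕ
    fits         : offset + length u ≤ length w
    entries      : ∀ {i} → i < length u → nth w (offset + i) ≡ nth u i + shift
open Factor

factor-occurrence : ∀ {u w} → Factor u w → Occurrence w u
factor-occurrence F = record
  { pos       = offset F +_
  ; pos-bound = λ i<n → <-≤-trans (+-monoʳ-< (offset F) i<n) (fits F)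
  ; pos-mono  = λ i<j _ → +-monoʳ-< (offset F) i<j
  ; preserves = λ i<n j<n lt →
      subst₂ _<_ (sym (entries F i<n)) (sym (entries F j<n)) (+-monoˡ-< (shift F) lt)
  ; reflects  = λ i<n j<n lt →
      +-cancelʳ-< (shift F) _ _ (subst₂ _<_ (entries F i<n) (entries F j<n) lt)
  }

pos-≥-first : ∀ {w p} (o : Occurrence w p) {i} → i < length p → pos o 0 ≤ pos o i
pos-≥-first o {zero}  _   = ≤-refl
pos-≥-first o {suc i} i<n = <⇒≤ (pos-mono o (s≤s z≤n) i<n)

pos-≤-last : ∀ {w p n} (o : Occurrence w p) → length p ≡ suc n →
             ∀ {i} → i < length p → pos o i ≤ pos o n
pos-≤-last o len i<n with m<1+n⇒m<n∨m≡n (subst (_ <_) len i<n)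
... | inj₁ i<n′ = <⇒≤ (pos-mono o i<n′ (subst (_ <_) (sym len) ≤-refl))
... | inj₂ refl = ≤-refl

occurrence-in-factor : ∀ {u w p n} (F : Factor u w) (o : Occurrence w p) → length p ≡ suc n →
  offset F ≤ pos o 0 → pos o n < offset F + length u → Occurrence u p
occurrence-in-factor {u} {w} {p} F o len first last = record
  { pos       = pos′
  ; pos-bound = inside
  ; pos-mono  = λ i<j j<n → +-cancelˡ-< (offset F) _ _
      (subst₂ _<_ (sym (recentre (<-trans i<j j<n))) (sym (recentre j<n)) (pos-mono o i<j j<n))
  ; preserves = λ i<n j<n lt → +-cancelʳ-< (shift F) _ _
      (subst₂ _<_ (entry i<n) (entry j<n) (preserves o i<n j<n lt))
  ; reflects  = λ i<n j<n lt → reflects o i<n j<n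
      (subst₂ _<_ (sym (entry i<n)) (sym (entry j<n)) (+-monoˡ-< (shift F) lt))
  }
  where
  pos′ : ℕ → ℕ
  pos′ i = pos o i ∸ offset F
  recentre : ∀ {i} → i < length p → offset F + pos′ i ≡ pos o i
  recentre i<n = m+[n∸m]≡n (≤-trans first (pos-≥-first o i<n))
  inside : ∀ {i} → i < length p → pos′ i < length u
  inside i<n = +-cancelˡ-< (offset F) _ _
    (subst (_< offset F + length u) (sym (recentre i<n)) (≤-<-trans (pos-≤-last o len i<n) last))
  entry : ∀ {i} → i < length p → nth w (pos o i) ≡ nth u (pos′ i) + shift F
  entry i<n = trans (cong (nth w) (sym (recentre i<n))) (entries F (inside i<n))

-- Permutations

perm-unique : ∀ {w} → IsPerm w → Unique w
perm-unique {w} w-perm = Unique-resp-↭ (↭⇒↭ₛ (↭-sym w-perm))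
  (Unique.map⁺ suc-injective (Unique.upTo⁺ (length w)))
  where open PermutationProperties (setoid ℕ) using (Unique-resp-↭)

perm-nth-bounds : ∀ {w k} → IsPerm w → k < length w → 1 ≤ nth w k × nth w k ≤ length w
perm-nth-bounds {w} w-perm k<n with v , v∈ , eq ← ∈-map⁻ suc (∈-resp-↭ w-perm (nth-∈ w k<n)) =
  subst (1 ≤_) (sym eq) (s≤s z≤n) , subst (_≤ length w) (sym eq) (∈-upTo⁻ v∈)

perm-surjective : ∀ {w v} → IsPerm w → 1 ≤ v → v ≤ length w →
                  ∃ λ k → k < length w × nth w k ≡ v
perm-surjective {w} {suc v} w-perm _ v≤n =
  ∈⇒nth w (∈-resp-↭ (↭-sym w-perm) (∈-map⁺ suc (∈-upTo⁺ v≤n)))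

length-inc : ∀ n → length (inc n) ≡ n
length-inc n = trans (length-map suc (upTo n)) (length-upTo n)

nth-inc : ∀ {n k} → k < n → nth (inc n) k ≡ suc k
nth-inc {n} k<n =
  trans (nth-map suc (upTo n) (subst (_ <_) (sym (length-upTo n)) k<n)) (cong suc (nth-applyUpTo _ n k<n))

applyUpTo-+ : ∀ (f : ℕ → ℕ) m n → applyUpTo f (m + n) ≡ applyUpTo f m ++ applyUpTo (f ∘ (m +_)) n
applyUpTo-+ f zero    n = refl
applyUpTo-+ f (suc m) n = cong (f 0 ∷_) (applyUpTo-+ (f ∘ suc) m n)

inc-+ : ∀ m n → inc (m + n) ≡ inc m ++ map (_+ m) (inc n)
inc-+ m n = begin
  inc (m + n)                                    ≡⟨ map-upTo suc (m + n) ⟩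
  applyUpTo suc (m + n)                          ≡⟨ applyUpTo-+ suc m n ⟩
  applyUpTo suc m ++ applyUpTo (suc ∘ (m +_)) n  ≡⟨ cong₂ _++_ (sym (map-upTo suc m)) shifted ⟩
  inc m ++ map (_+ m) (inc n)                    ∎
  where
  open ≡-Reasoning
  shifted : applyUpTo (suc ∘ (m +_)) n ≡ map (_+ m) (inc n)
  shifted = begin
    applyUpTo (suc ∘ (m +_)) n   ≡⟨ map-upTo (suc ∘ (m +_)) n ⟨
    map (suc ∘ (m +_)) (upTo n)  ≡⟨ map-cong (λ k → cong suc (+-comm m k)) (upTo n) ⟩
    map ((_+ m) ∘ suc) (upTo n)  ≡⟨ map-∘ (upTo n) ⟩
    map (_+ m) (inc n)           ∎

inc-isPerm : ∀ n → IsPerm (inc n)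
inc-isPerm n = ↭-reflexive (cong inc (sym (length-inc n)))

isPerm-resp-↭ : ∀ {xs ys} → xs ↭ ys → IsPerm ys → IsPerm xs
isPerm-resp-↭ {ys = ys} xs↭ys ys-perm =
  ↭-trans xs↭ys (subst (λ n → ys ↭ inc n) (sym (↭-length xs↭ys)) ys-perm)

++-cancelˡ : ∀ (xs : List ℕ) {ys zs} → xs ++ ys ↭ xs ++ zs → ys ↭ zs
++-cancelˡ []       ys↭zs = ys↭zs
++-cancelˡ (x ∷ xs) ys↭zs = ++-cancelˡ xs (drop-∷ ys↭zs)

map-+-∸ : ∀ c xs → map (_∸ c) (map (_+ c) xs) ≡ xs
map-+-∸ c xs = trans (sym (map-∘ xs)) (trans (map-cong (λ x → m+n∸n≡m x c) xs) (map-id xs))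

-- Direct sums

length-⊕ : ∀ π σ → length (π ⊕ σ) ≡ length π + length σ
length-⊕ π σ = trans (length-++ π) (cong (length π +_) (length-map _ σ))

⊕-factorˡ : ∀ π σ → Factor π (π ⊕ σ)
⊕-factorˡ π σ = record
  { offset = 0 ; shift = 0
  ; fits = subst (length π ≤_) (sym (length-⊕ π σ)) (m≤m+n _ _)
  ; entries = λ i<n → trans (nth-++ˡ π _ i<n) (sym (+-identityʳ _))
  }

⊕-factorʳ : ∀ π σ → Factor σ (π ⊕ σ)
⊕-factorʳ π σ = record
  { offset = length π ; shift = length π
  ; fits = ≤-reflexive (sym (length-⊕ π σ))
  ; entries = λ {i} i<n → trans (nth-++ʳ π _ i) (nth-map (_+ length π) σ i<n)
  }

⊕-isPerm : ∀ {π σ} → IsPerm π → IsPerm σ → IsPerm (π ⊕ σ)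
⊕-isPerm {π} {σ} π-perm σ-perm = ↭-trans (++⁺ π-perm (map⁺ (_+ length π) σ-perm))
  (↭-reflexive (trans (sym (inc-+ (length π) (length σ))) (cong inc (sym (length-⊕ π σ)))))

⊖-isPerm : ∀ {π σ} → IsPerm π → IsPerm σ → IsPerm (π ⊖ σ)
⊖-isPerm {π} {σ} π-perm σ-perm =
  isPerm-resp-↭ (++-comm (map (_+ length σ) π) σ) (⊕-isPerm σ-perm π-perm)

⊕-isPermʳ : ∀ {π σ} → IsPerm π → IsPerm (π ⊕ σ) → IsPerm σ
⊕-isPermʳ {π} {σ} π-perm π⊕σ-perm =
  subst₂ _↭_ (map-+-∸ L σ) (map-+-∸ L (inc n)) (map⁺ (_∸ L) (++-cancelˡ (inc L) split))
  where
  L n : ℕ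
  L = length π
  n = length σ
  split : inc L ++ map (_+ L) σ ↭ inc L ++ map (_+ L) (inc n)
  split = ↭-trans (++⁺ʳ _ (↭-sym π-perm))
    (subst (π ⊕ σ ↭_) (trans (cong inc (length-⊕ π σ)) (inc-+ L n)) π⊕σ-perm)

⊕-nth-≤ : ∀ {π σ k} → IsPerm π → k < length π → nth (π ⊕ σ) k ≤ length π
⊕-nth-≤ {π} π-perm k<n =
  subst (_≤ length π) (sym (nth-++ˡ π _ k<n)) (proj₂ (perm-nth-bounds π-perm k<n))

⊕-nth-> : ∀ {π σ k} → IsPerm σ → length π ≤ k → k < length (π ⊕ σ) →
          length π < nth (π ⊕ σ) k
⊕-nth-> {π} {σ} {k} σ-perm L≤k k<n = subst (length π <_) (sym entry)
  (+-monoˡ-≤ (length π) (proj₁ (perm-nth-bounds σ-perm i<n)))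
  where
  i = k ∸ length π
  k≡L+i : length π + i ≡ k
  k≡L+i = m+[n∸m]≡n L≤k
  i<n : i < length σ
  i<n = +-cancelˡ-< (length π) _ _ (subst₂ _<_ (sym k≡L+i) (length-⊕ π σ) k<n)
  entry : nth (π ⊕ σ) k ≡ nth σ i + length π
  entry = trans (cong (nth (π ⊕ σ)) (sym k≡L+i)) (entries (⊕-factorʳ π σ) i<n)

-- Entries in the left summand lie below those in the right one, so the two
-- ends of an inversion cannot be separated.
⊕-inversion-in-summand : ∀ {π σ p i j} → IsPerm π → IsPerm σ → (o : Occurrence (π ⊕ σ) p) →
  i < j → j < length p → nth p j < nth p i → pos o j < length π ⊎ length π ≤ pos o i
⊕-inversion-in-summand {π} {σ} {i = i} {j} π-perm σ-perm o i<j j<n inversion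
  with pos o i <? length π | pos o j <? length π
... | no  i-right | _           = inj₂ (≮⇒≥ i-right)
... | yes _       | yes j-left  = inj₁ j-left
... | yes i-left  | no  j-right = ⊥-elim (<-asym inversion (reflects o (<-trans i<j j<n) j<n
  (≤-<-trans (⊕-nth-≤ {π} {σ} π-perm i-left)
             (⊕-nth-> {π} {σ} σ-perm (≮⇒≥ j-right) (pos-bound o j<n)))))

occurrence-⊕ˡ : ∀ π σ {p n} (o : Occurrence (π ⊕ σ) p) → length p ≡ suc n →
  pos o n < length π → Occurrence π p
occurrence-⊕ˡ π σ o len = occurrence-in-factor (⊕-factorˡ π σ) o len z≤n

occurrence-⊕ʳ : ∀ π σ {p n} (o : Occurrence (π ⊕ σ) p) → length p ≡ suc n →
  length π ≤ pos o 0 → Occurrence σ p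
occurrence-⊕ʳ π σ {n = n} o len first = occurrence-in-factor (⊕-factorʳ π σ) o len first
  (subst (pos o n <_) (length-⊕ π σ) (pos-bound o (subst (n <_) (sym len) ≤-refl)))

⊕-avoids : ∀ {π σ p n} → IsPerm π → IsPerm σ → length p ≡ suc n → nth p n < nth p 0 →
  Avoids π p → Avoids σ p → Avoids (π ⊕ σ) p
⊕-avoids {π} {σ} {p} {n} π-perm σ-perm len inversion π-avoids σ-avoids =
  ¬occurrence-⊕ ∘ contains⇒occurrence
  where
  first<last : 0 < n
  first<last = n≢0⇒n>0 λ { refl → <-irrefl refl inversion }
  ¬occurrence-⊕ : ¬ Occurrence (π ⊕ σ) p
  ¬occurrence-⊕ o
    with ⊕-inversion-in-summand π-perm σ-perm o first<last (subst (n <_) (sym len) ≤-refl) inversion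
  ... | inj₁ last-left   = ¬occurrence π-avoids (occurrence-⊕ˡ π σ o len last-left)
  ... | inj₂ first-right = ¬occurrence σ-avoids (occurrence-⊕ʳ π σ o len first-right)

⊕-split : ∀ {w π} → length π ≤ length w →
  (∀ {k} → k < length π → nth w k ≡ nth π k) →
  (∀ {k} → length π ≤ k → k < length w → length π ≤ nth w k) →
  w ≡ π ⊕ map (_∸ length π) (drop (length π) w)
⊕-split {w} {π} L≤n prefix suffix = begin
  w                                        ≡⟨ take++drop≡id L w ⟨
  take L w ++ drop L w                     ≡⟨ cong₂ _++_ head tail ⟩
  π ++ map (_+ L) (map (_∸ L) (drop L w))  ∎
  where
  open ≡-Reasoning
  L : ℕ
  L = length π
  length-head : length (take L w) ≡ L
  length-head = trans (length-take L w) (m≤n⇒m⊓n≡m L≤n)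
  head : take L w ≡ π
  head = nth-ext length-head λ k<n → let k<L = subst (_ <_) length-head k<n in
    trans (nth-take L w k<L) (prefix k<L)
  large : ∀ {x} → x ∈ drop L w → L ≤ x
  large x∈ with k , k<n , refl ← ∈⇒nth (drop L w) x∈ = subst (L ≤_) (sym (nth-drop L w k))
    (suffix (m≤m+n L k) (subst (L + k <_) (m+[n∸m]≡n L≤n)
      (+-monoʳ-< L (subst (k <_) (length-drop L w) k<n))))
  tail : drop L w ≡ map (_+ L) (map (_∸ L) (drop L w))
  tail = sym (trans (sym (map-∘ (drop L w)))
    (map-id-local (All.tabulate λ x∈ → m∸n+n≡m (large x∈))))

-- The permutation 12⋯m ⊖ 1 = 23⋯(m+1)1

inc⊖1 : ℕ → List ℕ
inc⊖1 m = inc m ⊖ (1 ∷ [])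

length-inc⊖1 : ∀ m → length (inc⊖1 m) ≡ suc m
length-inc⊖1 m = trans (length-++ (map (_+ 1) (inc m)))
  (trans (cong (_+ 1) (trans (length-map _ (inc m)) (length-inc m))) (+-comm m 1))

inc⊖1-isPerm : ∀ m → IsPerm (inc⊖1 m)
inc⊖1-isPerm m = ⊖-isPerm (inc-isPerm m) (inc-isPerm 1)

nth-inc⊖1-< : ∀ {m x} → x < m → nth (inc⊖1 m) x ≡ suc (suc x)
nth-inc⊖1-< {m} {x} x<m = begin
  nth (inc⊖1 m) x             ≡⟨ nth-++ˡ (map (_+ 1) (inc m)) _
                                   (subst (x <_) (sym (length-map _ (inc m))) x<inc) ⟩
  nth (map (_+ 1) (inc m)) x  ≡⟨ nth-map (_+ 1) (inc m) x<inc ⟩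
  nth (inc m) x + 1           ≡⟨ cong (_+ 1) (nth-inc x<m) ⟩
  suc x + 1                   ≡⟨ +-comm (suc x) 1 ⟩
  suc (suc x)                 ∎
  where
  open ≡-Reasoning
  x<inc : x < length (inc m)
  x<inc = subst (x <_) (sym (length-inc m)) x<m

nth-inc⊖1-m : ∀ m → nth (inc⊖1 m) m ≡ 1
nth-inc⊖1-m m =
  subst (λ k → nth (inc⊖1 m) k ≡ 1) prefix-length (nth-++ʳ (map (_+ 1) (inc m)) (1 ∷ []) 0)
  where
  prefix-length : length (map (_+ 1) (inc m)) + 0 ≡ m
  prefix-length = trans (+-identityʳ _) (trans (length-map _ (inc m)) (length-inc m))

inc⊖1-descent : ∀ {m i j} → i < j → j < suc m →
  nth (inc⊖1 m) j < nth (inc⊖1 m) i → nth (inc⊖1 m) j ≡ 1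
inc⊖1-descent {m} i<j j<m+1 descent with m<1+n⇒m<n∨m≡n j<m+1
... | inj₂ refl = nth-inc⊖1-m m
... | inj₁ j<m  = ⊥-elim (<-asym i<j (≤-pred (≤-pred
  (subst₂ _<_ (nth-inc⊖1-< j<m) (nth-inc⊖1-< (<-trans i<j j<m)) descent))))

inc⊖1-avoids : ∀ {m p i j k} → i < j → j < length p → k < length p →
  nth p j < nth p i → nth p k < nth p j → Avoids (inc⊖1 m) p
inc⊖1-avoids {m} {p} {j = j} {k} i<j j<n k<n inversion smaller c = <⇒≱ below-one above-one
  where
  o : Occurrence (inc⊖1 m) p
  o = contains⇒occurrence c
  at-one : nth (inc⊖1 m) (pos o j) ≡ 1
  at-one = inc⊖1-descent (pos-mono o i<j j<n)
    (subst (pos o j <_) (length-inc⊖1 m) (pos-bound o j<n)) (preserves o j<n (<-trans i<j j<n) inversion)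
  below-one : nth (inc⊖1 m) (pos o k) < 1
  below-one = subst (nth (inc⊖1 m) (pos o k) <_) at-one (preserves o k<n j<n smaller)
  above-one : 1 ≤ nth (inc⊖1 m) (pos o k)
  above-one = proj₁ (perm-nth-bounds (inc⊖1-isPerm m) (pos-bound o k<n))

-- The structure of Av(312, 321, 1342)

shape⇒InAvB2 : ∀ {m σ} → IsFibonacci σ → InAvB2 (inc⊖1 m ⊕ σ)
shape⇒InAvB2 {m} {σ} (σ-perm , σ-avoids231 , σ-avoids312 , σ-avoids321) =
    ⊕-isPerm A-perm σ-perm
  , ⊕-avoids A-perm σ-perm refl (s<s (s<s z<s))
      (inc⊖1-avoids {m} {i = 0} {2} {1} z<s (s<s (s<s z<s)) (s<s z<s) (s<s (s<s z<s)) (s<s z<s))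
      σ-avoids312
  , ⊕-avoids A-perm σ-perm refl (s<s z<s)
      (inc⊖1-avoids {m} {i = 0} {1} {2} z<s (s<s z<s) (s<s (s<s z<s)) (s<s (s<s z<s)) (s<s z<s))
      σ-avoids321
  , ¬occurrence1342 ∘ contains⇒occurrence
  where
  A-perm : IsPerm (inc⊖1 m)
  A-perm = inc⊖1-isPerm m
  ¬occurrence1342 : ¬ Occurrence (inc⊖1 m ⊕ σ) (1 ∷ 3 ∷ 4 ∷ 2 ∷ [])
  ¬occurrence1342 o
    with ⊕-inversion-in-summand {i = 1} {3} A-perm σ-perm o (s<s z<s) (s<s (s<s (s<s z<s))) (s<s (s<s z<s))
  ... | inj₁ last-left = inc⊖1-avoids {m} {i = 1} {3} {0} (s<s z<s) (s<s (s<s (s<s z<s))) z<s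
          (s<s (s<s z<s)) (s<s z<s) (occurrence⇒contains (occurrence-⊕ˡ (inc⊖1 m) σ o refl last-left))
  ... | inj₂ second-right = ¬occurrence σ-avoids231 (occurrence-⊕ʳ (inc⊖1 m) σ o231 refl second-right)
    where
    -- 1342 = 1 ⊕ 231
    o231 : Occurrence (inc⊖1 m ⊕ σ) (2 ∷ 3 ∷ 1 ∷ [])
    o231 = occurrence-trans o (factor-occurrence (⊕-factorʳ (1 ∷ []) (2 ∷ 3 ∷ 1 ∷ [])))

module _ {w m} (w-perm : IsPerm w) (m<n : m < length w) (w[m]≡1 : nth w m ≡ 1) where

  one<nth : ∀ {k} → k < length w → k ≢ m → 1 < nth w k
  one<nth k<n k≢m with m≤n⇒m<n∨m≡n (proj₁ (perm-nth-bounds w-perm k<n))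
  ... | inj₁ 1<v = 1<v
  ... | inj₂ 1≡v = ⊥-elim (k≢m
    (nth-injective (perm-unique w-perm) k<n m<n (trans (sym 1≡v) (sym w[m]≡1))))

  nth-m<nth : ∀ {k} → k < length w → k ≢ m → nth w m < nth w k
  nth-m<nth {k} k<n k≢m = subst (_< nth w k) (sym w[m]≡1) (one<nth k<n k≢m)

  entries-distinct : ∀ {x y} → x < y → y < length w → nth w x ≢ nth w y
  entries-distinct x<y y<n = nth-distinct (perm-unique w-perm) x<y y<n

  -- With the 1 at position m, a descent before m would be a 321 ...
  avoids321⇒prefix-increasing : Avoids w (3 ∷ 2 ∷ 1 ∷ []) →
    ∀ {x y} → x < y → y < m → nth w x < nth w y
  avoids321⇒prefix-increasing avoids {x} {y} x<y y<m =
    ≤∧≢⇒< (≮⇒≥ (¬occurrence avoids ∘ occurrence321)) (entries-distinct x<y y<n)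
    where
    y<n : y < length w
    y<n = <-trans y<m m<n
    x<n : x < length w
    x<n = <-trans x<y y<n
    occurrence321 : nth w y < nth w x → Occurrence w (3 ∷ 2 ∷ 1 ∷ [])
    occurrence321 descent =
      occurrence-∷ (occurrence-∷ (occurrence-∷ occurrence-[] m<n (λ ()) (λ ())) y<n
        (λ { {0} _ → y<m ; {suc _} (s<s ()) })
        (λ { {0} _ → inj₂ (s<s z<s , nth-m<nth y<n (<⇒≢ y<m)) ; {suc _} (s<s ()) }))
      x<n
        (λ { {0} _ → x<y ; {1} _ → <-trans x<y y<m ; {suc (suc _)} (s<s (s<s ())) })
        (λ { {0} _ → inj₂ (s<s (s<s z<s) , descent)
           ; {1} _ → inj₂ (s<s z<s , nth-m<nth x<n (<⇒≢ (<-trans x<y y<m)))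
           ; {suc (suc _)} (s<s (s<s ())) })

  -- ... and an entry before m above one after m would be a 312.
  avoids312⇒prefix-below-suffix : Avoids w (3 ∷ 1 ∷ 2 ∷ []) →
    ∀ {x y} → x < m → m < y → y < length w → nth w x < nth w y
  avoids312⇒prefix-below-suffix avoids {x} {y} x<m m<y y<n =
    ≤∧≢⇒< (≮⇒≥ (¬occurrence avoids ∘ occurrence312)) (entries-distinct (<-trans x<m m<y) y<n)
    where
    x<n : x < length w
    x<n = <-trans x<m m<n
    occurrence312 : nth w y < nth w x → Occurrence w (3 ∷ 1 ∷ 2 ∷ [])
    occurrence312 inversion =
      occurrence-∷ (occurrence-∷ (occurrence-∷ occurrence-[] y<n (λ ()) (λ ())) m<n
        (λ { {0} _ → m<y ; {suc _} (s<s ()) })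
        (λ { {0} _ → inj₁ (s<s z<s , nth-m<nth y<n (≢-sym (<⇒≢ m<y))) ; {suc _} (s<s ()) }))
      x<n
        (λ { {0} _ → x<m ; {1} _ → <-trans x<m m<y ; {suc (suc _)} (s<s (s<s ())) })
        (λ { {0} _ → inj₂ (s<s z<s , nth-m<nth x<n (<⇒≢ x<m))
           ; {1} _ → inj₂ (s<s (s<s z<s) , inversion)
           ; {suc (suc _)} (s<s (s<s ())) })

  module _ (increasing : ∀ {x y} → x < y → y < m → nth w x < nth w y)
           (below : ∀ {x y} → x < m → m < y → y < length w → nth w x < nth w y) where

    prefix-lower : ∀ {x} → x < m → suc (suc x) ≤ nth w x
    prefix-lower {zero}  0<m   = one<nth (<-trans 0<m m<n) (<⇒≢ 0<m)
    prefix-lower {suc x} x+1<m =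
      ≤-trans (s≤s (prefix-lower (<-trans (n<1+n x) x+1<m))) (increasing (n<1+n x) x+1<m)

    later-above : ∀ {x k} → x < m → x < k → k < length w → k ≢ m → nth w x < nth w k
    later-above {k = k} x<m x<k k<n k≢m with <-cmp k m
    ... | tri< k<m _ _ = increasing x<k k<m
    ... | tri≈ _ k≡m _ = ⊥-elim (k≢m k≡m)
    ... | tri> _ _ m<k = below x<m m<k k<n

    -- The value x + 2 sits neither before x (induction) nor after x (it would
    -- then exceed nth w x ≥ x + 2).
    prefix-exact : ∀ {x} → x < m → nth w x ≡ suc (suc x)
    prefix-exact {x} = <-rec (λ x → x < m → nth w x ≡ suc (suc x)) step x
      where
      step : ∀ x → (∀ {y} → y < x → y < m → nth w y ≡ suc (suc y)) →
             x < m → nth w x ≡ suc (suc x)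
      step x earlier x<m
        with k , k<n , w[k]≡x+2 ← perm-surjective w-perm (s≤s z≤n)
               (≤-trans (prefix-lower x<m) (proj₂ (perm-nth-bounds w-perm (<-trans x<m m<n))))
        with <-cmp k x
      ... | tri< k<x _ _  = ⊥-elim (<⇒≢ k<x (suc-injective (suc-injective
              (trans (sym (earlier k<x (<-trans k<x x<m))) w[k]≡x+2))))
      ... | tri≈ _ refl _ = w[k]≡x+2
      ... | tri> _ _ x<k  = ⊥-elim (<⇒≱
              (subst (nth w x <_) w[k]≡x+2 (later-above x<m x<k k<n λ { refl →
                0≢1+n (suc-injective (trans (sym w[m]≡1) w[k]≡x+2)) }))
              (prefix-lower x<m))

    suffix-above : ∀ {k} → m < k → k < length w → m < nth w k
    suffix-above {k} m<k k<n with m <? nth w k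
    ... | yes m<v = m<v
    ... | no  m≮v = ⊥-elim (entries-distinct (<-trans j<m m<k) k<n (trans (prefix-exact j<m) j+2≡v))
      where
      j : ℕ
      j = nth w k ∸ 2
      j+2≡v : suc (suc j) ≡ nth w k
      j+2≡v = trans (+-comm 2 j) (m∸n+n≡m (one<nth k<n (≢-sym (<⇒≢ m<k))))
      j<m : j < m
      j<m = <-trans (n<1+n j) (subst (_≤ m) (sym j+2≡v) (≮⇒≥ m≮v))

    decomposition : w ≡ inc⊖1 m ⊕ map (_∸ length (inc⊖1 m)) (drop (length (inc⊖1 m)) w)
    decomposition =
      ⊕-split {π = inc⊖1 m} (subst (_≤ length w) (sym (length-inc⊖1 m)) m<n) prefix suffix
      where
      prefix : ∀ {k} → k < length (inc⊖1 m) → nth w k ≡ nth (inc⊖1 m) k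
      prefix k<L with m<1+n⇒m<n∨m≡n (subst (_ <_) (length-inc⊖1 m) k<L)
      ... | inj₁ k<m = trans (prefix-exact k<m) (sym (nth-inc⊖1-< k<m))
      ... | inj₂ refl = trans w[m]≡1 (sym (nth-inc⊖1-m m))
      suffix : ∀ {k} → length (inc⊖1 m) ≤ k → k < length w → length (inc⊖1 m) ≤ nth w k
      suffix {k} L≤k k<n = subst (_≤ nth w k) (sym (length-inc⊖1 m))
        (suffix-above (subst (_≤ k) (length-inc⊖1 m) L≤k) k<n)

InAvB2⇒isFibonacci-summand : ∀ {m σ} → InAvB2 (inc⊖1 m ⊕ σ) → IsFibonacci σ
InAvB2⇒isFibonacci-summand {m} {σ} (w-perm , avoids312 , avoids321 , avoids1342) =
  σ-perm , avoids-along prepend-1 avoids1342 , avoids-along in-w avoids312 , avoids-along in-w avoids321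
  where
  A : List ℕ
  A = inc⊖1 m
  σ-perm : IsPerm σ
  σ-perm = ⊕-isPermʳ (inc⊖1-isPerm m) w-perm
  in-w : ∀ {p} → Occurrence σ p → Occurrence (A ⊕ σ) p
  in-w = occurrence-trans (factor-occurrence (⊕-factorʳ A σ))
  m<A : m < length A
  m<A = subst (m <_) (sym (length-inc⊖1 m)) ≤-refl
  one : nth (A ⊕ σ) m ≡ 1
  one = trans (nth-++ˡ A _ m<A) (nth-inc⊖1-m m)
  -- 1342 = 1 ⊕ 231
  prepend-1 : Occurrence σ (2 ∷ 3 ∷ 1 ∷ []) → Occurrence (A ⊕ σ) (1 ∷ 3 ∷ 4 ∷ 2 ∷ [])
  prepend-1 o = occurrence-∷ o′ (<-≤-trans m<A (fits (⊕-factorˡ A σ)))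
    (λ _ → <-≤-trans m<A (m≤m+n _ _)) λ j<3 → inj₁ (one<pattern j<3 , one<entry j<3)
    where
    o′ : Occurrence (A ⊕ σ) (3 ∷ 4 ∷ 2 ∷ [])
    o′ = in-w (occurrence-map-+ 1 o)
    one<pattern : ∀ {j} → j < 3 → 1 < nth (3 ∷ 4 ∷ 2 ∷ []) j
    one<pattern {0} _ = s<s z<s
    one<pattern {1} _ = s<s z<s
    one<pattern {2} _ = s<s z<s
    one<pattern {suc (suc (suc _))} (s<s (s<s (s<s ())))
    one<entry : ∀ {j} → j < 3 → nth (A ⊕ σ) m < nth (A ⊕ σ) (pos o′ j)
    one<entry {j} j<3 = subst (_< nth (A ⊕ σ) (pos o′ j)) (sym one)
      (≤-<-trans (≤-trans (s≤s z≤n) m<A)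
                 (⊕-nth-> {A} {σ} σ-perm (m≤m+n _ _) (pos-bound o′ j<3)))

InAvB2⇒shape : ∀ {w} → w ≢ [] → InAvB2 w →
  Σ ℕ λ m → Σ (List ℕ) λ σ → IsFibonacci σ × w ≡ inc⊖1 m ⊕ σ
InAvB2⇒shape {[]} w≢[] _ = ⊥-elim (w≢[] refl)
InAvB2⇒shape {w@(_ ∷ _)} _ w-av@(w-perm , avoids312 , avoids321 , _)
  with m , m<n , w[m]≡1 ← perm-surjective w-perm (s≤s z≤n) (s≤s z≤n) =
  m , _ , InAvB2⇒isFibonacci-summand (subst InAvB2 w≡ w-av) , w≡
  where
  w≡ : w ≡ inc⊖1 m ⊕ _
  w≡ = decomposition w-perm m<n w[m]≡1
         (avoids321⇒prefix-increasing w-perm m<n w[m]≡1 avoids321)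
         (avoids312⇒prefix-below-suffix w-perm m<n w[m]≡1 avoids312)

theorem2p6 : (w : List ℕ) → w ≢ [] →
    InAvB2 w ⇔ Σ ℕ (λ m → Σ (List ℕ) (λ σ →
      IsFibonacci σ × w ≡ (inc m ⊖ (1 ∷ [])) ⊕ σ))
theorem2p6 w w≢[] = mk⇔ (InAvB2⇒shape w≢[]) λ { (_ , _ , σ-fib , refl) → shape⇒InAvB2 σ-fib }
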